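{- For any $S\subseteq\mathcal{P}[n]$ and any $i\in[n]$, $|\overrightarrow{\partial}_e(S)|\ge\min\{|\overrightarrow{\partial}_e(D_i(S))|,\ |\overrightarrow{\partial}_e(C_i(S))|\}$.
   Context: $Q_n$ is the hypercube graph on $\mathcal{P}[n]$, $[n]=\{1,\dots,n\}$, with $x\sim y$ iff $|x\triangle y|=1$. For $S\subseteq\mathcal{P}[n]$, $\overrightarrow{\partial}_e(S)$ is the set of edges of $Q_n$ whose smaller endpoint (under inclusion) lies in $S$ and whose larger endpoint lies in $S^c$. For $i\in[n]$, $C_i(S)=\{x\in S: x\setminus\{i\}\in S\}$ and $D_i(S)=S\cup\{x: x\cup\{i\}\in S\}$. -}

module Defs where

open import Data.Nat using (ℕ; zero; suc; _+_)
open import Data.Bool using (Bool; true; false; _∧_; _∨_; not; if_then_else_)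
open import Data.Fin using (Fin)
open import Data.Vec using (Vec; []; _∷_; lookup; _[_]≔_)
open import Data.List using (List; []; _∷_; map; _++_; concatMap; filter; length)
open import Data.List using () renaming (allFin to allFinL)
open import Data.Fin.Subset using (Subset)
open import Data.Product using (_×_; _,_; proj₁; proj₂)
open import Data.Bool using (_≟_)

-- Vertices of Q_n: subsets of [n] = Fin n, encoded as characteristic vectors.

allSubsets : (n : ℕ) → List (Subset n)
allSubsets zero = [] ∷ []
allSubsets (suc n) = map (false ∷_) (allSubsets n) ++ map (true ∷_) (allSubsets n)

Family : ℕ → Set
Family n = Subset n → Bool

remove : ∀ {n} → Subset n → Fin n → Subset n
remove x i = x [ i ]≔ false

insert : ∀ {n} → Subset n → Fin n → Subset n
insert x i = x [ i ]≔ true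

C : ∀ {n} → Fin n → Family n → Family n
C i S x = S x ∧ S (remove x i)

D : ∀ {n} → Fin n → Family n → Family n
D i S x = S x ∨ S (insert x i)

-- Each edge of Q_n is uniquely the pair (x, x ∪ {j}) with j ∉ x.
-- The directed edge boundary: such edges with x ∈ S and x ∪ {j} ∉ S.
isBoundaryEdge : ∀ {n} → Family n → Subset n → Fin n → Bool
isBoundaryEdge S x j =
  if lookup x j then false else (S x ∧ not (S (insert x j)))

edgeBoundarySize : (n : ℕ) → Family n → ℕ
edgeBoundarySize n S =
  length (filter (λ p → _≟_ (isBoundaryEdge S (proj₁ p) (proj₂ p)) true)
    (concatMap (λ x → map (λ j → (x , j)) (allFinL n)) (allSubsets n)))

module Submission where

-- Proof idea.  Write lo(x) = x \ {i} and hi(x) = x ∪ {i}; the sets of P[n]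
-- split into i-pairs {lo(x), hi(x)}.  We prove the stronger, averaged bound
--
--     |∂D_i(S)| + |∂C_i(S)|  ≤  2 |∂S| ,
--
-- from which  min(|∂D_i(S)|, |∂C_i(S)|) ≤ |∂S|  is immediate.
--
-- Counting every boundary edge at its lower endpoint, twice |∂T| equals the sum,
-- over all x, of the number of boundary edges leaving the i-pair of x
-- (sumOver-pairs, boundary-double).  The bound is therefore local: for one
-- i-pair and one direction j, the edges of D_i(S) and C_i(S) leaving the pair
-- number at most twice those of S.  For j = i this is an equality; for j ≠ i
-- it reduces to a Boolean fact: the union and the intersection of two points'
-- memberships lose no more j-edges than the two points do
-- (union-intersection-edges).

open import Defs
open import Function using (_∘_)
open import Data.Nat using (ℕ; _≥_; _⊓_; suc; _+_; _≤_; z≤n)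
open import Data.Nat.Properties
  using (+-assoc; ≤-refl; ≤ᵇ⇒≤; +-mono-≤; +-monoˡ-≤; +-mono-<; <⇒≱; ≮⇒≥; m⊓n≤m; m⊓n≤n;
         +-commutativeSemigroup; module ≤-Reasoning)
open import Algebra.Properties.CommutativeSemigroup +-commutativeSemigroup using (interchange)
open import Data.Nat.Solver using (module +-*-Solver)
open import Data.Fin using (Fin) renaming (zero to fzero; suc to fsuc)
open import Data.Fin.Properties using () renaming (_≟_ to _≟ᶠ_)
open import Data.Fin.Subset using (Subset)
open import Data.Bool using (Bool; true; false; _∧_; _∨_; not) renaming (_≟_ to _≟ᵇ_)
open import Data.Bool.Properties using (∨-idem; ∧-idem)
open import Data.Vec using (_∷_; lookup; _[_]≔_)
open import Data.Vec.Properties using ([]≔-idempotent; []≔-commutes; lookup∘update; lookup∘update′)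
open import Data.List using (List; []; _∷_; map; _++_; concatMap; filter; length; concat)
open import Data.List using () renaming (allFin to allFinL)
open import Data.Product using (_×_; _,_; proj₁; proj₂)
open import Relation.Binary.PropositionalEquality
open import Relation.Nullary using (yes; no)

ind : Bool → ℕ
ind true  = 1
ind false = 0

sumOver : {A : Set} → (A → ℕ) → List A → ℕ
sumOver f []       = 0
sumOver f (x ∷ xs) = f x + sumOver f xs

sumOver-++ : {A : Set} (f : A → ℕ) (xs ys : List A) →
  sumOver f (xs ++ ys) ≡ sumOver f xs + sumOver f ys
sumOver-++ f []       ys = refl
sumOver-++ f (x ∷ xs) ys = trans (cong (f x +_) (sumOver-++ f xs ys)) (sym (+-assoc (f x) _ _))

sumOver-map : {A B : Set} (f : B → ℕ) (g : A → B) (xs : List A) →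
  sumOver f (map g xs) ≡ sumOver (f ∘ g) xs
sumOver-map f g []       = refl
sumOver-map f g (x ∷ xs) = cong (f (g x) +_) (sumOver-map f g xs)

sumOver-cong : {A : Set} {f g : A → ℕ} (xs : List A) → (∀ x → f x ≡ g x) →
  sumOver f xs ≡ sumOver g xs
sumOver-cong []       eq = refl
sumOver-cong (x ∷ xs) eq = cong₂ _+_ (eq x) (sumOver-cong xs eq)

sumOver-concatMap : {A B : Set} (f : B → ℕ) (h : A → List B) (xs : List A) →
  sumOver f (concatMap h xs) ≡ sumOver (sumOver f ∘ h) xs
sumOver-concatMap f h []       = refl
sumOver-concatMap f h (x ∷ xs) =
  trans (sumOver-++ f (h x) (concat (map h xs))) (cong (sumOver f (h x) +_) (sumOver-concatMap f h xs))

sumOver-+ : {A : Set} (f g : A → ℕ) (xs : List A) →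
  sumOver (λ x → f x + g x) xs ≡ sumOver f xs + sumOver g xs
sumOver-+ f g []       = refl
sumOver-+ f g (x ∷ xs) =
  trans (cong (f x + g x +_) (sumOver-+ f g xs)) (interchange (f x) (g x) _ _)

sumOver-+-mono : {A : Set} {f g h k : A → ℕ} (xs : List A) →
  (∀ x → f x + g x ≤ h x + k x) →
  sumOver f xs + sumOver g xs ≤ sumOver h xs + sumOver k xs
sumOver-+-mono {f = f} {g} {h} {k} []       le = z≤n
sumOver-+-mono {f = f} {g} {h} {k} (x ∷ xs) le = begin
  (f x + sumOver f xs) + (g x + sumOver g xs)  ≡⟨ interchange (f x) _ (g x) _ ⟩
  (f x + g x) + (sumOver f xs + sumOver g xs)  ≤⟨ +-mono-≤ (le x) (sumOver-+-mono xs le) ⟩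
  (h x + k x) + (sumOver h xs + sumOver k xs)  ≡⟨ interchange (h x) (k x) _ _ ⟩
  (h x + sumOver h xs) + (k x + sumOver k xs)  ∎
  where open ≤-Reasoning

count-filter : {A : Set} (f : A → Bool) (xs : List A) →
  length (filter (λ p → f p ≟ᵇ true) xs) ≡ sumOver (ind ∘ f) xs
count-filter f []       = refl
count-filter f (x ∷ xs) with f x
... | true  = cong suc (count-filter f xs)
... | false = count-filter f xs

sumOver-allSubsets : ∀ n (G : Subset (suc n) → ℕ) →
  sumOver G (allSubsets (suc n)) ≡
  sumOver (λ x → G (false ∷ x)) (allSubsets n) + sumOver (λ x → G (true ∷ x)) (allSubsets n)
sumOver-allSubsets n G =
  trans (sumOver-++ G (map (false ∷_) L) (map (true ∷_) L))
        (cong₂ _+_ (sumOver-map G (false ∷_) L) (sumOver-map G (true ∷_) L))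
  where L = allSubsets n

-- Summing F over P[n] twice is the same as summing, for every x, F over both
-- ends lo(x), hi(x) of the i-pair of x: each pair is visited once from either end.
sumOver-pairs : ∀ n (F : Subset n → ℕ) (i : Fin n) →
  sumOver F (allSubsets n) + sumOver F (allSubsets n) ≡
  sumOver (λ x → F (remove x i) + F (insert x i)) (allSubsets n)
sumOver-pairs (suc n) F i = begin
  sumOver F A + sumOver F A                 ≡⟨ cong (λ t → t + t) (sumOver-allSubsets n F) ⟩
  (P + Q) + (P + Q)                         ≡⟨ pairs i ⟩
  sumOver (pairSum ∘ (false ∷_)) L
    + sumOver (pairSum ∘ (true ∷_)) L       ≡⟨ sumOver-allSubsets n pairSum ⟨
  sumOver pairSum A                         ∎
  where
  open ≡-Reasoning
  L = allSubsets n
  A = allSubsets (suc n)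
  F₀ F₁ : Subset n → ℕ
  F₀ x = F (false ∷ x)
  F₁ x = F (true ∷ x)
  P = sumOver F₀ L
  Q = sumOver F₁ L
  pairSum : Subset (suc n) → ℕ
  pairSum x = F (remove x i) + F (insert x i)
  -- For i = 0 the pair of b ∷ x is {false ∷ x, true ∷ x}; otherwise the
  -- first coordinate is untouched and the induction hypothesis applies.
  pairs : ∀ i → (P + Q) + (P + Q) ≡
    sumOver (λ x → F (remove (false ∷ x) i) + F (insert (false ∷ x) i)) L
      + sumOver (λ x → F (remove (true ∷ x) i) + F (insert (true ∷ x) i)) L
  pairs fzero    = cong (λ t → t + t) (sym (sumOver-+ F₀ F₁ L))
  pairs (fsuc i) = trans (interchange P Q P Q)
                         (cong₂ _+_ (sumOver-pairs n F₀ i) (sumOver-pairs n F₁ i))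

outBoundary : ∀ {n} → Family n → Subset n → ℕ
outBoundary {n} T x = sumOver (λ j → ind (isBoundaryEdge T x j)) (allFinL n)

boundary-as-sum : ∀ n (T : Family n) → edgeBoundarySize n T ≡ sumOver (outBoundary T) (allSubsets n)
boundary-as-sum n T = begin
  edgeBoundarySize n T                                  ≡⟨ count-filter edge (concatMap edgesAt X) ⟩
  sumOver (ind ∘ edge) (concatMap edgesAt X)            ≡⟨ sumOver-concatMap (ind ∘ edge) edgesAt X ⟩
  sumOver (λ x → sumOver (ind ∘ edge) (edgesAt x)) X    ≡⟨ sumOver-cong X (λ x → sumOver-map (ind ∘ edge) (x ,_) (allFinL n)) ⟩
  sumOver (outBoundary T) X                             ∎
  where
  open ≡-Reasoning
  X = allSubsets n
  edge : Subset n × Fin n → Bool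
  edge p = isBoundaryEdge T (proj₁ p) (proj₂ p)
  edgesAt : Subset n → List (Subset n × Fin n)
  edgesAt x = map (x ,_) (allFinL n)

pairBoundary : ∀ {n} → Family n → Fin n → Subset n → ℕ
pairBoundary T i x = outBoundary T (remove x i) + outBoundary T (insert x i)

boundary-double : ∀ n (T : Family n) (i : Fin n) →
  edgeBoundarySize n T + edgeBoundarySize n T ≡ sumOver (pairBoundary T i) (allSubsets n)
boundary-double n T i rewrite boundary-as-sum n T = sumOver-pairs n (outBoundary T) i

edge-from-top : ∀ {n} (T : Family n) (v : Subset n) (j : Fin n) →
  lookup v j ≡ true → isBoundaryEdge T v j ≡ false
edge-from-top T v j eq rewrite eq = refl

edge-from-bottom : ∀ {n} (T : Family n) (v : Subset n) (j : Fin n) →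
  lookup v j ≡ false → isBoundaryEdge T v j ≡ T v ∧ not (T (insert v j))
edge-from-bottom T v j eq rewrite eq = refl

-- Values of the compressions on an i-pair {lo(v), hi(v)}: D_i moves the pair
-- "up" (lo gets the union of the pair), C_i moves it "down" (hi gets the intersection).
module PairValues {n} (S : Family n) (i : Fin n) (v : Subset n) where
  D-lower : D i S (remove v i) ≡ S (remove v i) ∨ S (insert v i)
  D-lower = cong (λ w → S (remove v i) ∨ S w) ([]≔-idempotent v i)

  D-upper : D i S (insert v i) ≡ S (insert v i)
  D-upper = trans (cong (λ w → S (insert v i) ∨ S w) ([]≔-idempotent v i)) (∨-idem _)

  C-lower : C i S (remove v i) ≡ S (remove v i)
  C-lower = trans (cong (λ w → S (remove v i) ∧ S w) ([]≔-idempotent v i)) (∧-idem _)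

  C-upper : C i S (insert v i) ≡ S (insert v i) ∧ S (remove v i)
  C-upper = cong (λ w → S (insert v i) ∧ S w) ([]≔-idempotent v i)

open PairValues

pairEdges : ∀ {n} → Family n → Fin n → Subset n → Fin n → ℕ
pairEdges T i x j = ind (isBoundaryEdge T (remove x i) j) + ind (isBoundaryEdge T (insert x i) j)

pairEdges-along : ∀ {n} (T : Family n) (i : Fin n) (x : Subset n) →
  pairEdges T i x i ≡ ind (T (remove x i) ∧ not (T (insert x i))) + 0
pairEdges-along T i x = cong₂ _+_
  (cong ind (trans (edge-from-bottom T (remove x i) i (lookup∘update i x false))
                   (cong (λ w → T (remove x i) ∧ not (T w)) ([]≔-idempotent x i))))
  (cong ind (edge-from-top T (insert x i) i (lookup∘update i x true)))

-- In a direction j ≠ i the pair has edges only if j ∉ x, and they then go to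
-- the i-pair of x ∪ {j}, since setting coordinates i and j commutes.
pairEdges-across-top : ∀ {n} (T : Family n) {i j : Fin n} (x : Subset n) → j ≢ i →
  lookup x j ≡ true → pairEdges T i x j ≡ 0 + 0
pairEdges-across-top T {i} {j} x j≢i j∈x = cong₂ _+_
  (cong ind (edge-from-top T (remove x i) j (trans (lookup∘update′ j≢i x false) j∈x)))
  (cong ind (edge-from-top T (insert x i) j (trans (lookup∘update′ j≢i x true) j∈x)))

pairEdges-across-bottom : ∀ {n} (T : Family n) {i j : Fin n} (x : Subset n) → j ≢ i →
  lookup x j ≡ false →
  pairEdges T i x j ≡ ind (T (remove x i) ∧ not (T (remove (insert x j) i)))
                        + ind (T (insert x i) ∧ not (T (insert (insert x j) i)))
pairEdges-across-bottom T {i} {j} x j≢i j∉x = cong₂ _+_ (edgeAt false) (edgeAt true)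
  where
  edgeAt : ∀ u → ind (isBoundaryEdge T (x [ i ]≔ u) j)
                 ≡ ind (T (x [ i ]≔ u) ∧ not (T ((insert x j) [ i ]≔ u)))
  edgeAt u = cong ind (trans (edge-from-bottom T (x [ i ]≔ u) j (trans (lookup∘update′ j≢i x u) j∉x))
                             (cong (λ w → T (x [ i ]≔ u) ∧ not (T w))
                                   ([]≔-commutes x i j (j≢i ∘ sym))))

union-intersection-edges : ∀ a b a' b' →
  ind ((a ∨ b) ∧ not (a' ∨ b')) + ind ((b ∧ a) ∧ not (b' ∧ a')) ≤ ind (a ∧ not a') + ind (b ∧ not b')
union-intersection-edges true  true  true  true  = ≤ᵇ⇒≤ _ _ _
union-intersection-edges true  true  true  false = ≤ᵇ⇒≤ _ _ _
union-intersection-edges true  true  false true  = ≤ᵇ⇒≤ _ _ _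
union-intersection-edges true  true  false false = ≤ᵇ⇒≤ _ _ _
union-intersection-edges true  false true  b'    = ≤ᵇ⇒≤ _ _ _
union-intersection-edges true  false false true  = ≤ᵇ⇒≤ _ _ _
union-intersection-edges true  false false false = ≤ᵇ⇒≤ _ _ _
union-intersection-edges false true  true  b'    = ≤ᵇ⇒≤ _ _ _
union-intersection-edges false true  false true  = ≤ᵇ⇒≤ _ _ _
union-intersection-edges false true  false false = ≤ᵇ⇒≤ _ _ _
union-intersection-edges false false a'    b'    = z≤n

-- Edge counts of D_i(S) and C_i(S) on one i-pair, in terms of a = [lo ∈ S],
-- b = [hi ∈ S] (and a', b' for the j-neighbouring pair when j ≠ i).
along-direction-count : ∀ a b →
  (ind ((a ∨ b) ∧ not b) + 0) + (ind (a ∧ not (b ∧ a)) + 0) ≤ (ind (a ∧ not b) + 0) + (ind (a ∧ not b) + 0)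
along-direction-count true  true  = ≤-refl
along-direction-count true  false = ≤-refl
along-direction-count false true  = ≤-refl
along-direction-count false false = ≤-refl

cross-direction-count : ∀ a b a' b' →
  (ind ((a ∨ b) ∧ not (a' ∨ b')) + ind (b ∧ not b')) + (ind (a ∧ not a') + ind ((b ∧ a) ∧ not (b' ∧ a')))
    ≤ (ind (a ∧ not a') + ind (b ∧ not b')) + (ind (a ∧ not a') + ind (b ∧ not b'))
cross-direction-count a b a' b' = begin
  (U + B) + (A + I)  ≡⟨ solve 4 (λ u b a i → (u :+ b) :+ (a :+ i) := (u :+ i) :+ (a :+ b)) refl U B A I ⟩
  (U + I) + (A + B)  ≤⟨ +-monoˡ-≤ (A + B) (union-intersection-edges a b a' b') ⟩
  (A + B) + (A + B)  ∎
  where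
  open ≤-Reasoning
  open +-*-Solver
  U = ind ((a ∨ b) ∧ not (a' ∨ b'))
  I = ind ((b ∧ a) ∧ not (b' ∧ a'))
  A = ind (a ∧ not a')
  B = ind (b ∧ not b')

compression-pairEdges : ∀ {n} (S : Family n) (i : Fin n) (x : Subset n) (j : Fin n) →
  pairEdges (D i S) i x j + pairEdges (C i S) i x j ≤ pairEdges S i x j + pairEdges S i x j
compression-pairEdges S i x j with j ≟ᶠ i
... | yes refl
  rewrite pairEdges-along (D j S) j x | pairEdges-along (C j S) j x | pairEdges-along S j x
        | D-lower S j x | D-upper S j x | C-lower S j x | C-upper S j x
  = along-direction-count (S (remove x j)) (S (insert x j))
... | no j≢i with lookup x j in j∈?x
...   | true
  rewrite pairEdges-across-top (D i S) x j≢i j∈?x | pairEdges-across-top (C i S) x j≢i j∈?x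
        | pairEdges-across-top S x j≢i j∈?x
  = z≤n
...   | false
  rewrite pairEdges-across-bottom (D i S) x j≢i j∈?x | pairEdges-across-bottom (C i S) x j≢i j∈?x
        | pairEdges-across-bottom S x j≢i j∈?x
        | D-lower S i x | D-upper S i x | C-lower S i x | C-upper S i x
        | D-lower S i (insert x j) | D-upper S i (insert x j)
        | C-lower S i (insert x j) | C-upper S i (insert x j)
  = cross-direction-count (S (remove x i)) (S (insert x i))
                          (S (remove (insert x j) i)) (S (insert (insert x j) i))

pairBoundary-by-direction : ∀ {n} (T : Family n) (i : Fin n) (x : Subset n) →
  pairBoundary T i x ≡ sumOver (pairEdges T i x) (allFinL n)
pairBoundary-by-direction {n} T i x = sym (sumOver-+
  (λ j → ind (isBoundaryEdge T (remove x i) j)) (λ j → ind (isBoundaryEdge T (insert x i) j)) (allFinL n))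

compression-pairBoundary : ∀ {n} (S : Family n) (i : Fin n) (x : Subset n) →
  pairBoundary (D i S) i x + pairBoundary (C i S) i x ≤ pairBoundary S i x + pairBoundary S i x
compression-pairBoundary {n} S i x
  rewrite pairBoundary-by-direction (D i S) i x | pairBoundary-by-direction (C i S) i x
        | pairBoundary-by-direction S i x
  = sumOver-+-mono (allFinL n) (compression-pairEdges S i x)

halve : ∀ {m n} → m + m ≤ n + n → m ≤ n
halve m+m≤n+n = ≮⇒≥ (λ n<m → <⇒≱ (+-mono-< n<m n<m) m+m≤n+n)

min-below-average : ∀ d c s → (d + d) + (c + c) ≤ (s + s) + (s + s) → s ≥ d ⊓ c
min-below-average d c s le = halve (halve (begin
  (d ⊓ c + d ⊓ c) + (d ⊓ c + d ⊓ c)  ≤⟨ +-mono-≤ (+-mono-≤ (m⊓n≤m d c) (m⊓n≤m d c))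
                                                (+-mono-≤ (m⊓n≤n d c) (m⊓n≤n d c)) ⟩
  (d + d) + (c + c)                  ≤⟨ le ⟩
  (s + s) + (s + s)                  ∎))
  where open ≤-Reasoning

mainTheorem6 : (n : ℕ) (S : Family n) (i : Fin n) →
    edgeBoundarySize n S ≥ (edgeBoundarySize n (D i S) ⊓ edgeBoundarySize n (C i S))
mainTheorem6 n S i = min-below-average ∂D ∂C ∂S (begin
  (∂D + ∂D) + (∂C + ∂C)
    ≡⟨ cong₂ _+_ (boundary-double n (D i S) i) (boundary-double n (C i S) i) ⟩
  sumOver (pairBoundary (D i S) i) X + sumOver (pairBoundary (C i S) i) X
    ≤⟨ sumOver-+-mono X (compression-pairBoundary S i) ⟩
  sumOver (pairBoundary S i) X + sumOver (pairBoundary S i) X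
    ≡⟨ cong₂ _+_ (boundary-double n S i) (boundary-double n S i) ⟨
  (∂S + ∂S) + (∂S + ∂S)  ∎)
  where
  open ≤-Reasoning
  X = allSubsets n
  ∂S = edgeBoundarySize n S
  ∂D = edgeBoundarySize n (D i S)
  ∂C = edgeBoundarySize n (C i S)
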